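{- Let $G=(V,E)$ be a cubic graph and let $S$ be the string constructed from $G$ as described in the context. Let $R$ be a run subsequence of $S$. If $R$ does not contain some separation substring $S_{Sep,i}$, $1\le i\le m+n$, then there exists a run subsequence $R'$ of $S$ that contains $S_{Sep,i}$ and such that $|R'|>|R|$.
   Context: A run in a string is a maximal substring of consecutive identical symbols. A run subsequence of a string $S$ over alphabet $\Sigma$ is a subsequence of $S$ containing at most one run for each symbol (for each symbol, its chosen occurrences are consecutive in the subsequence); its length is the number of chosen positions. Construction. Let $G=(V,E)$ be a cubic graph with $V=\{v_1,\dots,v_n\}$ and $|E|=m$. For an edge $\{v_i,v_j\}$ with $i<j$ introduce symbols $x^i_{i,j}, x^j_{i,j}, e^1_{i,j}, e^2_{i,j}$; for $v_i$ and a neighbour $v_j$ write $x^i_{\{i,j\}}$ for $x^i_{\min(i,j),\max(i,j)}$. The alphabet is $\Sigma=\{w_i\}\cup\{x^i_{i,j},x^j_{i,j},e^1_{i,j},e^2_{i,j}\}\cup\{\sharp_{i,z}:1\le i\le m+n,1\le z\le 3\}$. For $v_i$ with neighbours $v_j,v_h,v_z$, $j<h<z$, let $S(v_i)=w_i\,x^i_{\{i,j\}}\,x^i_{\{i,h\}}\,x^i_{\{i,z\}}\,w_i$. For each edge $\{v_i,v_j\}$, $i<j$, let $S(e_{i,j})=e^1_{i,j}\,x^i_{i,j}\,e^2_{i,j}\,e^1_{i,j}\,x^j_{i,j}\,e^2_{i,j}$. For $1\le i\le m+n$ let $S_{Sep,i}=\sharp_{i,1}\sharp_{i,2}\sharp_{i,3}$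 (separation substrings). Listing the edges in lexicographic order as $\epsilon_1,\dots,\epsilon_m$, set $S=S(v_1)S_{Sep,1}\cdots S(v_n)S_{Sep,n}S(\epsilon_1)S_{Sep,n+1}\cdots S(\epsilon_m)S_{Sep,n+m}$. "$R$ contains $S_{Sep,i}$" means all three symbols of $S_{Sep,i}$ are in $R$. -}

module Defs where

open import Data.Nat using (ℕ; zero; suc; _+_; _<ᵇ_; _≤_; _<_)
open import Data.Bool using (Bool; true; false; if_then_else_; _∧_)
open import Data.Fin using (Fin; toℕ) renaming (_<_ to _<ᶠ_)
open import Data.Product using (_×_; _,_; Σ; ∃)
open import Data.List using (List; []; _∷_; _++_; length; filterᵇ; concatMap; concat; map; allFin; lookup)
open import Data.List.Membership.Propositional using (_∈_)
open import Data.List.Relation.Binary.Sublist.Propositional using (_⊆_)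
open import Relation.Binary.PropositionalEquality using (_≡_)

-- A (simple) cubic graph on vertex set Fin n (vertex v_{i+1} is index i).
record CubicGraph (n : ℕ) : Set where
  field
    adj     : Fin n → Fin n → Bool
    adj-sym : ∀ i j → adj i j ≡ adj j i
    irrefl  : ∀ i → adj i i ≡ false
    cubic   : ∀ i → length (filterᵇ (adj i) (allFin n)) ≡ 3

data Sym (n : ℕ) : Set where
  w     : Fin n → Sym n
  x     : Fin n → Fin n → Fin n → Sym n   -- x k i j  =  x^k_{i,j}  (i < j, k ∈ {i,j})
  e¹    : Fin n → Fin n → Sym n
  e²    : Fin n → Fin n → Sym n
  sharp : ℕ → Fin 3 → Sym n               -- sharp i z = ♯_{i,z+1}, i ∈ [1, m+n]

module Construction {n : ℕ} (G : CubicGraph n) where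
  open CubicGraph G

  xv : Fin n → Fin n → Sym n
  xv i j = if toℕ i <ᵇ toℕ j then x i i j else x i j i

  nbrs : Fin n → List (Fin n)
  nbrs i = filterᵇ (adj i) (allFin n)

  Svert : Fin n → List (Sym n)
  Svert i = w i ∷ (map (xv i) (nbrs i) ++ (w i ∷ []))

  edges : List (Fin n × Fin n)
  edges = concatMap (λ i → concatMap (λ j →
            if adj i j ∧ (toℕ i <ᵇ toℕ j) then (i , j) ∷ [] else []) (allFin n)) (allFin n)

  m : ℕ
  m = length edges

  Sedge : Fin n → Fin n → List (Sym n)
  Sedge i j = e¹ i j ∷ x i i j ∷ e² i j ∷ e¹ i j ∷ x j i j ∷ e² i j ∷ []

  Sep : ℕ → List (Sym n)
  Sep k = sharp k Fin.zero ∷ sharp k (Fin.suc Fin.zero) ∷ sharp k (Fin.suc (Fin.suc Fin.zero)) ∷ []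
    where import Data.Fin as Fin

  edgePart : ℕ → List (Fin n × Fin n) → List (Sym n)
  edgePart k [] = []
  edgePart k ((i , j) ∷ es) = Sedge i j ++ (Sep k ++ edgePart (suc k) es)

  S : List (Sym n)
  S = concatMap (λ i → Svert i ++ Sep (suc (toℕ i))) (allFin n) ++ edgePart (suc n) edges

-- R is a run subsequence of T: a subsequence in which, for every symbol,
-- its occurrences are consecutive (at most one run per symbol).
HasRunProperty : {A : Set} → List A → Set
HasRunProperty {A} R = ∀ (a : A) (p q r : Fin (length R)) → p <ᶠ q → q <ᶠ r →
  lookup R p ≡ a → lookup R r ≡ a → lookup R q ≡ a

IsRunSubseq : {A : Set} → List A → List A → Set
IsRunSubseq R T = (R ⊆ T) × HasRunProperty R

ContainsSep : {n : ℕ} → ℕ → List (Sym n) → Set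
ContainsSep k R = ∀ (z : Fin 3) → sharp k z ∈ R

-- Write S = P ++ S_{Sep,i} ++ Q and split R accordingly as R₁ ++ Rₛ ++ R₂. Separator symbols
-- occur once in S and every other symbol at most three times (w_i twice, x^i_{i,j} once in S(v_i)
-- and once in S(e_{i,j}), e^1, e^2 twice). If R₁ and R₂ share no symbol, R₁ ++ S_{Sep,i} ++ R₂ is
-- a run subsequence, longer because Rₛ is a proper part of S_{Sep,i}. Otherwise a shared symbol a
-- has a single run crossing the separator, so Rₛ is empty and a is the only shared symbol; since
-- a occurs in P, it occurs at most twice in R₂, and deleting it there while inserting S_{Sep,i}
-- still gains a symbol.
module Submission where

open import Defs
open import Data.Bool using (true; false; if_then_else_; _∧_)
open import Data.Empty using (⊥; ⊥-elim)
open import Data.Fin using (Fin; toℕ; fromℕ<) renaming (zero to fzero; suc to fsuc)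
import Data.Fin.Properties as Fin
open import Data.List using (List; []; _∷_; _++_; length; map; filter; concatMap; head; allFin)
open import Data.List.Properties
  using (filter-++; length-++; ++-assoc; ++-identityʳ; filter-none; filter-some; filter-accept)
import Data.List.Membership.DecPropositional as DecMembership
open import Data.List.Membership.Propositional using (_∈_; _∉_; find; lose)
open import Data.List.Membership.Propositional.Properties
  using (∈-++⁺ˡ; ∈-++⁺ʳ; ∈-++⁻; ∈-lookup; ∈-filter⁻; ∈-concatMap⁻; ∈-map⁻; ∈-allFin)
open import Data.List.Relation.Binary.Equality.Propositional using (≋⇒≡)
open import Data.List.Relation.Binary.Sublist.Propositional using (_⊆_; []; _∷_; _∷ʳ_; ⊆-refl; ⊆-trans)
open import Data.List.Relation.Binary.Sublist.Propositional.Properties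
  using (filter⁺; filter-⊆; length-mono-≤; ++⁺; to-≋; Any-resp-⊆)
open import Data.List.Relation.Unary.All using (All; []; _∷_)
import Data.List.Relation.Unary.All as All
open import Data.List.Relation.Unary.All.Properties using (¬Any⇒All¬)
open import Data.List.Relation.Unary.AllPairs using ([]; _∷_)
open import Data.List.Relation.Unary.Any using (here; there; index; any?)
open import Data.List.Relation.Unary.Any.Properties using (lookup-index)
open import Data.List.Relation.Unary.Unique.Propositional using (Unique)
open import Data.List.Relation.Unary.Unique.Propositional.Properties using (Unique[x∷xs]⇒x∉xs; allFin⁺)
import Data.List.Relation.Unary.Unique.Propositional.Properties as Unique
open import Data.Maybe using (Maybe; just; nothing)
import Data.Maybe.Properties as Maybe
open import Data.Nat using (ℕ; zero; suc; _+_; _∸_; _≤_; _<_; z≤n; s≤s; _<?_; _<ᵇ_)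
open import Data.Nat.ListAction using (sum)
import Data.Nat.Properties as ℕ
open import Data.Product using (Σ; ∃; ∃₂; _×_; _,_; proj₁; proj₂; uncurry)
import Data.Product.Properties as ×
open import Data.Sum using (_⊎_; inj₁; inj₂)
import Data.Sum.Properties as ⊎
open import Data.Unit using (⊤; tt)
open import Function using (_∘_)
open import Relation.Binary.Definitions using (DecidableEquality)
open import Relation.Binary.PropositionalEquality
open import Relation.Nullary using (¬_; Dec; yes; no; ¬?; contradiction)
open import Relation.Nullary.Decidable using (map′; T?)
open import Relation.Unary using (Pred; Decidable)

module _ {A : Set} where

  private variable
    a b : A
    l xs ys zs R : List A

  Contiguous : List A → Set
  Contiguous []      = ⊤
  Contiguous (b ∷ l) = (b ∈ l → head l ≡ just b) × Contiguous l

  hasRunProperty-∷⁻ : HasRunProperty (b ∷ l) → HasRunProperty l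
  hasRunProperty-∷⁻ run a p q r (p<q) (q<r) = run a (fsuc p) (fsuc q) (fsuc r) (s≤s p<q) (s≤s q<r)

  hasRunProperty⇒head : HasRunProperty (b ∷ l) → b ∈ l → head l ≡ just b
  hasRunProperty⇒head run (here b≡c) = cong just (sym b≡c)
  hasRunProperty⇒head {b} run (there m) = cong just
    (run b fzero (fsuc fzero) (fsuc (fsuc (index m))) (s≤s z≤n) (s≤s (s≤s z≤n)) refl (sym (lookup-index m)))

  hasRunProperty⇒contiguous : HasRunProperty R → Contiguous R
  hasRunProperty⇒contiguous {[]}    run = tt
  hasRunProperty⇒contiguous {b ∷ l} run =
    hasRunProperty⇒head run , hasRunProperty⇒contiguous (hasRunProperty-∷⁻ run)

  contiguous⇒hasRunProperty : Contiguous R → HasRunProperty R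
  contiguous⇒hasRunProperty {b ∷ l} (_ , c) a (fsuc p) (fsuc q) (fsuc r) (s≤s p<q) (s≤s q<r) =
    contiguous⇒hasRunProperty c a p q r p<q q<r
  contiguous⇒hasRunProperty {b ∷ c ∷ l} (next , _) a fzero (fsuc fzero) (fsuc r) _ _ refl l[r]≡b =
    Maybe.just-injective (next (subst (_∈ c ∷ l) l[r]≡b (∈-lookup r)))
  contiguous⇒hasRunProperty {b ∷ c ∷ l} (next , cont) a fzero (fsuc (fsuc q)) (fsuc (fsuc r)) _ (s≤s q<r) refl l[r]≡b =
    contiguous⇒hasRunProperty cont b fzero (fsuc q) (fsuc r) (s≤s z≤n) q<r
      (Maybe.just-injective (next (subst (_∈ c ∷ l) l[r]≡b (∈-lookup (fsuc r))))) l[r]≡b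

  head-++ : ∀ xs → head xs ≡ just b → head (xs ++ ys) ≡ just b
  head-++ (c ∷ xs) e = e

  contiguous-++⁻ˡ : ∀ xs → Contiguous (xs ++ ys) → Contiguous xs
  contiguous-++⁻ˡ []           _             = tt
  contiguous-++⁻ˡ (b ∷ [])     _             = (λ ()) , tt
  contiguous-++⁻ˡ (b ∷ c ∷ xs) (next , cont) = next ∘ ∈-++⁺ˡ , contiguous-++⁻ˡ (c ∷ xs) cont

  contiguous-++⁻ʳ : ∀ xs → Contiguous (xs ++ ys) → Contiguous ys
  contiguous-++⁻ʳ []       c       = c
  contiguous-++⁻ʳ (b ∷ xs) (_ , c) = contiguous-++⁻ʳ xs c

  contiguous-++⁺ : ∀ xs → Contiguous xs → Contiguous ys → (∀ {c} → c ∈ xs → c ∉ ys) →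
                   Contiguous (xs ++ ys)
  contiguous-++⁺ []       _           cy _    = cy
  contiguous-++⁺ (b ∷ xs) (next , cx) cy disj = next′ , contiguous-++⁺ xs cx cy (disj ∘ there)
    where
    next′ : b ∈ xs ++ _ → head (xs ++ _) ≡ just b
    next′ m with ∈-++⁻ xs m
    ... | inj₁ m′ = head-++ xs (next m′)
    ... | inj₂ m′ = ⊥-elim (disj (here refl) m′)

  contiguous-++-head : ∀ xs → Contiguous (xs ++ ys) → a ∈ xs → a ∈ ys → head ys ≡ just a
  contiguous-++-head (b ∷ xs)     (_ , cont)    (there m)   m′ = contiguous-++-head xs cont m m′
  contiguous-++-head (b ∷ [])     (next , _)    (here refl) m′ = next m′
  contiguous-++-head (b ∷ c ∷ xs) (next , cont) (here refl) m′ =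
    contiguous-++-head (c ∷ xs) cont (here (Maybe.just-injective (sym (next (∈-++⁺ʳ (c ∷ xs) m′))))) m′

  contiguous-sandwich : ∀ xs → Contiguous (xs ++ ys ++ zs) → a ∈ xs → a ∈ zs → a ∉ ys → ys ≡ []
  contiguous-sandwich {ys = []}     _  _    _    _    _    = refl
  contiguous-sandwich {ys = y ∷ ys} xs cont a∈xs a∈zs a∉ys
    with contiguous-++-head xs cont a∈xs (∈-++⁺ʳ (y ∷ ys) a∈zs)
  ... | refl = contradiction (here refl) a∉ys

  head-filter : ∀ {ℓ} {P : Pred A ℓ} (P? : Decidable P) → P b → head l ≡ just b →
                head (filter P? l) ≡ just b
  head-filter {l = c ∷ l} P? Pb refl = cong head (filter-accept P? Pb)

  contiguous-filter : ∀ {ℓ} {P : Pred A ℓ} (P? : Decidable P) → Contiguous xs → Contiguous (filter P? xs)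
  contiguous-filter {xs = []} P? _ = tt
  contiguous-filter {xs = b ∷ l} P? (next , cont) with P? b
  ... | no  _  = contiguous-filter P? cont
  ... | yes Pb = head-filter P? Pb ∘ next ∘ proj₁ ∘ ∈-filter⁻ P? , contiguous-filter P? cont

  unique⇒contiguous : Unique xs → Contiguous xs
  unique⇒contiguous {[]}    _            = tt
  unique⇒contiguous {b ∷ l} u@(_ ∷ u′) = ⊥-elim ∘ Unique[x∷xs]⇒x∉xs u , unique⇒contiguous u′

  length-++-monoʳ-< : ∀ (xs ys zs : List A) → length ys < length zs → length (xs ++ ys) < length (xs ++ zs)
  length-++-monoʳ-< xs ys zs lt =
    subst₂ _<_ (sym (length-++ xs)) (sym (length-++ xs)) (ℕ.+-monoʳ-< (length xs) lt)

  length-++-monoˡ-< : ∀ (xs ys zs : List A) → length xs < length ys → length (xs ++ zs) < length (ys ++ zs)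
  length-++-monoˡ-< xs ys zs lt =
    subst₂ _<_ (sym (length-++ xs)) (sym (length-++ ys)) (ℕ.+-monoˡ-< (length zs) lt)

  ⊆-++-split : ∀ xs → R ⊆ xs ++ ys →
               ∃₂ λ R₁ R₂ → R ≡ R₁ ++ R₂ × R₁ ⊆ xs × R₂ ⊆ ys
  ⊆-++-split []       τ = [] , _ , refl , [] , τ
  ⊆-++-split (y ∷ ys′) (_ ∷ʳ τ) with ⊆-++-split ys′ τ
  ... | R₁ , R₂ , eq , τ₁ , τ₂ = R₁ , R₂ , eq , y ∷ʳ τ₁ , τ₂
  ⊆-++-split (y ∷ ys′) (refl ∷ τ) with ⊆-++-split ys′ τ
  ... | R₁ , R₂ , eq , τ₁ , τ₂ = y ∷ R₁ , R₂ , cong (y ∷_) eq , refl ∷ τ₁ , τ₂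

module _ {A : Set} where

  _IsInfixOf_ : List A → List A → Set
  B IsInfixOf T = ∃₂ λ P Q → T ≡ P ++ B ++ Q

  infix-++ˡ : ∀ {B T} X → B IsInfixOf T → B IsInfixOf (X ++ T)
  infix-++ˡ {B} X (P , Q , refl) = X ++ P , Q , sym (++-assoc X P (B ++ Q))

  infix-++ʳ : ∀ {B T} Y → B IsInfixOf T → B IsInfixOf (T ++ Y)
  infix-++ʳ {B} Y (P , Q , refl) = P , Q ++ Y , trans (++-assoc P (B ++ Q) Y) (cong (P ++_) (++-assoc B Q Y))

  infix-concatMap : ∀ {C : Set} {B} (f : C → List A) {c cs} → c ∈ cs → B IsInfixOf f c →
                    B IsInfixOf concatMap f cs
  infix-concatMap f {cs = c ∷ cs} (here refl) B-infix = infix-++ʳ (concatMap f cs) B-infix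
  infix-concatMap f {cs = c ∷ cs} (there c∈)  B-infix = infix-++ˡ (f c) (infix-concatMap f c∈ B-infix)

  unique-if-singleton : ∀ t (a : A) → Unique (if t then a ∷ [] else [])
  unique-if-singleton true  _ = [] ∷ []
  unique-if-singleton false _ = []

  ∈-if-singleton : ∀ t {a b : A} → b ∈ (if t then a ∷ [] else []) → b ≡ a
  ∈-if-singleton true (here refl) = refl

unique-concatMap⁺ : ∀ {A B : Set} {f : B → List A} (π : A → B) {bs} → Unique bs → (∀ b → Unique (f b)) →
                    (∀ {a b} → a ∈ f b → π a ≡ b) → Unique (concatMap f bs)
unique-concatMap⁺ π {[]}     _          _        _   = []
unique-concatMap⁺ {f = f} π {b ∷ bs} (b∉ ∷ u) unique-f tag =
  Unique.++⁺ (unique-f b) (unique-concatMap⁺ π u unique-f tag) disjoint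
  where
  disjoint : ∀ {a} → ¬ (a ∈ f b × a ∈ concatMap f bs)
  disjoint (a∈fb , a∈rest) with find (∈-concatMap⁻ f a∈rest)
  ... | b′ , b′∈bs , a∈fb′ = All.lookup b∉ b′∈bs (trans (sym (tag a∈fb)) (tag a∈fb′))

sum-map-≡0 : ∀ {A : Set} {f : A → ℕ} {xs} → All (λ a → f a ≡ 0) xs → sum (map f xs) ≡ 0
sum-map-≡0 []          = refl
sum-map-≡0 (fa≡0 ∷ ps) = cong₂ _+_ fa≡0 (sum-map-≡0 ps)

sum-map-≤-singleSupport : ∀ {A : Set} {f : A → ℕ} {c xs} → Unique xs →
  (∀ {a b} → 0 < f a → 0 < f b → a ≡ b) → (∀ a → f a ≤ c) → sum (map f xs) ≤ c
sum-map-≤-singleSupport []                   _       _     = z≤n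
sum-map-≤-singleSupport {f = f} {c} {a ∷ xs} (a∉ ∷ u) support bound with 0 <? f a
... | no  fa≯0 = begin
  f a + sum (map f xs) ≡⟨ cong (_+ sum (map f xs)) (ℕ.n≤0⇒n≡0 (ℕ.≮⇒≥ fa≯0)) ⟩
  sum (map f xs)       ≤⟨ sum-map-≤-singleSupport u support bound ⟩
  c                    ∎
  where open ℕ.≤-Reasoning
... | yes fa>0 = begin
  f a + sum (map f xs) ≡⟨ cong (f a +_) (sum-map-≡0 (All.map vanish a∉)) ⟩
  f a + 0              ≡⟨ ℕ.+-identityʳ (f a) ⟩
  f a                  ≤⟨ bound a ⟩
  c                    ∎
  where
  open ℕ.≤-Reasoning
  vanish : ∀ {b} → a ≢ b → f b ≡ 0
  vanish a≢b = ℕ.n≤0⇒n≡0 (ℕ.≮⇒≥ (a≢b ∘ support fa>0))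

module Counting {A : Set} (_≟_ : DecidableEquality A) where

  open DecMembership _≟_ using (_∈?_)

  private variable
    a : A
    xs ys : List A

  count : A → List A → ℕ
  count a = length ∘ filter (a ≟_)

  remove : A → List A → List A
  remove a = filter (λ b → ¬? (a ≟ b))

  count-++ : ∀ a xs → count a (xs ++ ys) ≡ count a xs + count a ys
  count-++ {ys = ys} a xs = trans (cong length (filter-++ (a ≟_) xs ys)) (length-++ (filter (a ≟_) xs))

  count-concatMap : ∀ {B : Set} (f : B → List A) bs → count a (concatMap f bs) ≡ sum (map (count a ∘ f) bs)
  count-concatMap f []       = refl
  count-concatMap f (b ∷ bs) = trans (count-++ _ (f b)) (cong (_ +_) (count-concatMap f bs))

  count-mono : xs ⊆ ys → count a xs ≤ count a ys
  count-mono {a = a} τ = length-mono-≤ (filter⁺ (a ≟_) (a ≟_) (λ { refl p → p }) τ)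

  ∈⇒count-pos : a ∈ xs → 0 < count a xs
  ∈⇒count-pos {a} = filter-some (a ≟_)

  ∉⇒count≡0 : a ∉ xs → count a xs ≡ 0
  ∉⇒count≡0 {a} {xs} a∉ = cong length (filter-none (a ≟_) (¬Any⇒All¬ xs a∉))

  count-pos⇒∈ : 0 < count a xs → a ∈ xs
  count-pos⇒∈ {a} {xs} pos with a ∈? xs
  ... | yes a∈ = a∈
  ... | no  a∉ = contradiction (∉⇒count≡0 a∉) (ℕ.>⇒≢ pos)

  unique⇒count≤1 : ∀ a → Unique xs → count a xs ≤ 1
  unique⇒count≤1 {[]}     _ _ = z≤n
  unique⇒count≤1 {b ∷ xs} a u@(_ ∷ u′) with a ≟ b
  ... | yes refl = s≤s (ℕ.≤-reflexive (∉⇒count≡0 (Unique[x∷xs]⇒x∉xs u)))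
  ... | no  _    = unique⇒count≤1 a u′

  count-++-∉ʳ : ∀ a xs → a ∉ ys → count a (xs ++ ys) ≡ count a xs
  count-++-∉ʳ {ys = ys} a xs a∉ys = trans (count-++ a xs) (trans (cong (count a xs +_) (∉⇒count≡0 a∉ys)) (ℕ.+-identityʳ _))

  count-++-++ : ∀ a xs ys {zs} → count a (xs ++ ys ++ zs) ≡ count a xs + (count a ys + count a zs)
  count-++-++ a xs ys = trans (count-++ a xs) (cong (count a xs +_) (count-++ a ys))

  count≤1⇒∉-sides : ∀ xs {ys zs} → count a (xs ++ ys ++ zs) ≤ 1 → a ∈ ys → a ∉ xs × a ∉ zs
  count≤1⇒∉-sides {a} xs {ys} {zs} ≤1 a∈ys =
    (λ a∈xs → twice (ℕ.+-mono-≤ (∈⇒count-pos a∈xs) (ℕ.≤-trans (∈⇒count-pos a∈ys) (ℕ.m≤m+n _ _)))) ,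
    (λ a∈zs → twice (ℕ.≤-trans (ℕ.+-mono-≤ (∈⇒count-pos a∈ys) (∈⇒count-pos a∈zs)) (ℕ.m≤n+m _ (count a xs))))
    where
    twice : 2 ≤ count a xs + (count a ys + count a zs) → ⊥
    twice 2≤ with ℕ.≤-trans 2≤ (subst (_≤ 1) (count-++-++ a xs ys) ≤1)
    ... | s≤s ()

  count-right< : ∀ xs {ys zs c} → count a (xs ++ ys ++ zs) ≤ c → a ∈ xs → count a zs < c
  count-right< {a} xs {ys} {zs} {c} ≤c a∈xs = begin-strict
    count a zs                             <⟨ ℕ.+-monoˡ-< (count a zs) (∈⇒count-pos a∈xs) ⟩
    count a xs + count a zs                ≤⟨ ℕ.+-monoʳ-≤ (count a xs) (ℕ.m≤n+m _ (count a ys)) ⟩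
    count a xs + (count a ys + count a zs) ≡⟨ count-++-++ a xs ys ⟨
    count a (xs ++ ys ++ zs)               ≤⟨ ≤c ⟩
    c                                      ∎
    where open ℕ.≤-Reasoning

  count-[-]≤1 : ∀ a b → count a (b ∷ []) ≤ 1
  count-[-]≤1 a b = unique⇒count≤1 a ([] ∷ [])

  length-remove : ∀ xs → length xs ≡ count a xs + length (remove a xs)
  length-remove []            = refl
  length-remove {a} (b ∷ xs) with a ≟ b
  ... | yes _ = cong suc (length-remove xs)
  ... | no  _ = trans (cong suc (length-remove xs)) (sym (ℕ.+-suc _ _))

module Exchange {A : Set} (_≟_ : DecidableEquality A) where

  open Counting _≟_
  open DecMembership _≟_ using (_∈?_)

  ExchangeResult : List A → List A → List A → Set
  ExchangeResult T B R = ∃ λ R′ → R′ ⊆ T × Contiguous R′ × All (_∈ R′) B × length R < length R′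

  module _ {P B Q : List A} (unique-B : Unique B) (B∉P : ∀ {b} → b ∈ B → b ∉ P) (B∉Q : ∀ {b} → b ∈ B → b ∉ Q)
           {R₁ R₂ : List A} (R₁⊆P : R₁ ⊆ P) (R₂⊆Q : R₂ ⊆ Q)
           (contiguous-R₁ : Contiguous R₁) (contiguous-R₂ : Contiguous R₂) where

    private
      B-inside : ∀ R₂′ → All (_∈ R₁ ++ B ++ R₂′) B
      B-inside R₂′ = All.tabulate (∈-++⁺ʳ R₁ ∘ ∈-++⁺ˡ)

      contiguous-insert : ∀ {R₂′} → R₂′ ⊆ Q → Contiguous R₂′ → (∀ {c} → c ∈ R₁ → c ∉ R₂′) →
                          Contiguous (R₁ ++ B ++ R₂′)
      contiguous-insert {R₂′} R₂′⊆Q contiguous-R₂′ R₁∉R₂′ =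
        contiguous-++⁺ R₁ contiguous-R₁
          (contiguous-++⁺ B (unique⇒contiguous unique-B) contiguous-R₂′ (λ c∈B → B∉Q c∈B ∘ Any-resp-⊆ R₂′⊆Q))
          R₁∉B++R₂′
        where
        R₁∉B++R₂′ : ∀ {c} → c ∈ R₁ → c ∉ B ++ R₂′
        R₁∉B++R₂′ c∈R₁ c∈ with ∈-++⁻ B c∈
        ... | inj₁ c∈B  = B∉P c∈B (Any-resp-⊆ R₁⊆P c∈R₁)
        ... | inj₂ c∈R₂′ = R₁∉R₂′ c∈R₁ c∈R₂′

    exchange-disjoint : ∀ {Rs} → Rs ⊆ B → (∀ {c} → c ∈ R₁ → c ∉ R₂) → ¬ All (_∈ R₁ ++ Rs ++ R₂) B →
                        ExchangeResult (P ++ B ++ Q) B (R₁ ++ Rs ++ R₂)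
    exchange-disjoint {Rs} Rs⊆B R₁∉R₂ B⊄R =
      R₁ ++ B ++ R₂ , ++⁺ R₁⊆P (++⁺ ⊆-refl R₂⊆Q) , contiguous-insert R₂⊆Q contiguous-R₂ R₁∉R₂ , B-inside R₂ ,
      length-++-monoʳ-< R₁ (Rs ++ R₂) (B ++ R₂) (length-++-monoˡ-< Rs B R₂ Rs<B)
      where
      Rs≢B : length Rs ≢ length B
      Rs≢B eq with ≋⇒≡ (to-≋ eq Rs⊆B)
      ... | refl = B⊄R (B-inside R₂)

      Rs<B : length Rs < length B
      Rs<B = ℕ.≤∧≢⇒< (length-mono-≤ Rs⊆B) Rs≢B

    exchange-shared : Contiguous (R₁ ++ R₂) → ∀ {a} → a ∈ R₁ → a ∈ R₂ → count a Q < length B →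
                      ExchangeResult (P ++ B ++ Q) B (R₁ ++ R₂)
    exchange-shared contiguous-R {a} a∈R₁ a∈R₂ fewInQ =
      R₁ ++ B ++ R₂′ , ++⁺ R₁⊆P (++⁺ ⊆-refl R₂′⊆Q) , contiguous-insert R₂′⊆Q contiguous-R₂′ R₁∉R₂′ , B-inside R₂′ ,
      length-++-monoʳ-< R₁ R₂ (B ++ R₂′) R₂<
      where
      R₂′ = remove a R₂

      R₂′⊆Q : R₂′ ⊆ Q
      R₂′⊆Q = ⊆-trans (filter-⊆ (λ b → ¬? (a ≟ b)) R₂) R₂⊆Q

      contiguous-R₂′ : Contiguous R₂′
      contiguous-R₂′ = contiguous-filter (λ b → ¬? (a ≟ b)) contiguous-R₂

      R₁∉R₂′ : ∀ {c} → c ∈ R₁ → c ∉ R₂′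
      R₁∉R₂′ c∈R₁ c∈R₂′ with ∈-filter⁻ (λ b → ¬? (a ≟ b)) c∈R₂′
      ... | c∈R₂ , a≢c = a≢c (Maybe.just-injective (trans
            (sym (contiguous-++-head R₁ contiguous-R a∈R₁ a∈R₂))
            (contiguous-++-head R₁ contiguous-R c∈R₁ c∈R₂)))

      R₂< : length R₂ < length (B ++ R₂′)
      R₂< = begin-strict
        length R₂                     ≡⟨ length-remove R₂ ⟩
        count a R₂ + length R₂′       ≤⟨ ℕ.+-monoˡ-≤ _ (count-mono R₂⊆Q) ⟩
        count a Q + length R₂′        <⟨ ℕ.+-monoˡ-< _ fewInQ ⟩
        length B + length R₂′         ≡⟨ sym (length-++ B) ⟩
        length (B ++ R₂′)             ∎
        where open ℕ.≤-Reasoning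

  exchange : ∀ {P B Q R} → Unique B → (∀ {b} → b ∈ B → b ∉ P) → (∀ {b} → b ∈ B → b ∉ Q) →
             (∀ {a} → a ∈ P → count a Q < length B) →
             R ⊆ P ++ B ++ Q → Contiguous R → ¬ All (_∈ R) B → ExchangeResult (P ++ B ++ Q) B R
  exchange {P} {B} unique-B B∉P B∉Q fewInQ R⊆ contiguous-R B⊄R
    with ⊆-++-split P R⊆
  ... | R₁ , R₂₃ , refl , R₁⊆P , R₂₃⊆ with ⊆-++-split B R₂₃⊆
  ... | Rs , R₂ , refl , Rs⊆B , R₂⊆Q with any? (_∈? R₂) R₁
  ... | no R₁∉R₂ = exchange-disjoint unique-B B∉P B∉Q R₁⊆P R₂⊆Q contiguous-R₁ contiguous-R₂ Rs⊆B
                     (λ c∈R₁ c∈R₂ → R₁∉R₂ (lose c∈R₁ c∈R₂)) B⊄R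
    where
    contiguous-R₁ = contiguous-++⁻ˡ R₁ contiguous-R
    contiguous-R₂ = contiguous-++⁻ʳ Rs (contiguous-++⁻ʳ R₁ contiguous-R)
  ... | yes shared with find shared
  ... | a , a∈R₁ , a∈R₂
      with contiguous-sandwich R₁ contiguous-R a∈R₁ a∈R₂ (λ a∈Rs → B∉P (Any-resp-⊆ Rs⊆B a∈Rs) (Any-resp-⊆ R₁⊆P a∈R₁))
  ... | refl = exchange-shared unique-B B∉P B∉Q R₁⊆P R₂⊆Q (contiguous-++⁻ˡ R₁ contiguous-R)
                 (contiguous-++⁻ʳ R₁ contiguous-R) contiguous-R a∈R₁ a∈R₂ (fewInQ (Any-resp-⊆ R₁⊆P a∈R₁))

module _ {n : ℕ} where

  private
    Code : Set
    Code = Fin n ⊎ (Fin n × Fin n × Fin n) ⊎ (Fin n × Fin n) ⊎ (Fin n × Fin n) ⊎ (ℕ × Fin 3)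

    encode : Sym n → Code
    encode (w a)       = inj₁ a
    encode (x k a b)   = inj₂ (inj₁ (k , a , b))
    encode (e¹ a b)    = inj₂ (inj₂ (inj₁ (a , b)))
    encode (e² a b)    = inj₂ (inj₂ (inj₂ (inj₁ (a , b))))
    encode (sharp k z) = inj₂ (inj₂ (inj₂ (inj₂ (k , z))))

    decode : Code → Sym n
    decode (inj₁ a)                                 = w a
    decode (inj₂ (inj₁ (k , a , b)))                = x k a b
    decode (inj₂ (inj₂ (inj₁ (a , b))))             = e¹ a b
    decode (inj₂ (inj₂ (inj₂ (inj₁ (a , b)))))      = e² a b
    decode (inj₂ (inj₂ (inj₂ (inj₂ (k , z)))))      = sharp k z

    decode-encode : ∀ s → decode (encode s) ≡ s
    decode-encode (w a)       = refl
    decode-encode (x k a b)   = refl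
    decode-encode (e¹ a b)    = refl
    decode-encode (e² a b)    = refl
    decode-encode (sharp k z) = refl

    _≟ᶜ_ : DecidableEquality Code
    _≟ᶜ_ = ⊎.≡-dec Fin._≟_ (⊎.≡-dec (×.≡-dec Fin._≟_ (×.≡-dec Fin._≟_ Fin._≟_))
             (⊎.≡-dec (×.≡-dec Fin._≟_ Fin._≟_) (⊎.≡-dec (×.≡-dec Fin._≟_ Fin._≟_) (×.≡-dec ℕ._≟_ Fin._≟_))))

  -- On symbols with different constructors this evaluates to `no`, so below a count such as
  -- count (w a) (Sedge i j) reduces to 0 by computation.
  _≟ₛ_ : DecidableEquality (Sym n)
  s ≟ₛ t = map′ encode-injective (cong encode) (encode s ≟ᶜ encode t)
    where
    encode-injective : encode s ≡ encode t → s ≡ t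
    encode-injective e = trans (sym (decode-encode s)) (trans (cong decode e) (decode-encode t))

  vertexOf : Sym n → Maybe (Fin n)
  vertexOf (w a)     = just a
  vertexOf (x k _ _) = just k
  vertexOf _         = nothing

  edgeOf : Sym n → Maybe (Fin n × Fin n)
  edgeOf (x _ a b) = just (a , b)
  edgeOf (e¹ a b)  = just (a , b)
  edgeOf (e² a b)  = just (a , b)
  edgeOf _         = nothing

  separatorOf : Sym n → Maybe ℕ
  separatorOf (sharp k _) = just k
  separatorOf _           = nothing

  vertexWeight : Sym n → ℕ
  vertexWeight (w _)     = 2
  vertexWeight (x _ _ _) = 1
  vertexWeight _         = 0

  edgeWeight : Sym n → ℕ
  edgeWeight (w _) = 0
  edgeWeight _     = 2

  weights≤3 : ∀ s → vertexWeight s + edgeWeight s ≤ 3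
  weights≤3 (w _)       = s≤s (s≤s z≤n)
  weights≤3 (x _ _ _)   = ℕ.≤-refl
  weights≤3 (e¹ _ _)    = s≤s (s≤s z≤n)
  weights≤3 (e² _ _)    = s≤s (s≤s z≤n)
  weights≤3 (sharp _ _) = s≤s (s≤s z≤n)

module Gadgets {n : ℕ} (G : CubicGraph n) where

  open CubicGraph G
  open Construction G
  open Counting (_≟ₛ_ {n})
  open Exchange (_≟ₛ_ {n})

  private variable
    s : Sym n
    i j : Fin n
    k : ℕ

  xv-form : ∀ i j → ∃₂ λ b c → xv i j ≡ x i b c
  xv-form i j = by-order (toℕ i <ᵇ toℕ j)
    where
    by-order : ∀ t → ∃₂ λ b c → (if t then x i i j else x i j i) ≡ x i b c
    by-order true  = _ , _ , refl
    by-order false = _ , _ , refl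

  xv-injective : ∀ i {j j′} → xv i j ≡ xv i j′ → j ≡ j′
  xv-injective i {j} {j′} = by-order (toℕ i <ᵇ toℕ j) (toℕ i <ᵇ toℕ j′)
    where
    by-order : ∀ t t′ → (if t then x i i j else x i j i) ≡ (if t′ then x i i j′ else x i j′ i) → j ≡ j′
    by-order true  true  refl = refl
    by-order true  false refl = refl
    by-order false true  refl = refl
    by-order false false refl = refl

  unique-Svert-xs : ∀ i → Unique (map (xv i) (nbrs i))
  unique-Svert-xs i = Unique.map⁺ (xv-injective i) (Unique.filter⁺ (T? ∘ adj i) (allFin⁺ n))

  ∈-Svert-xs : s ∈ map (xv i) (nbrs i) → ∃₂ λ b c → s ≡ x i b c
  ∈-Svert-xs {i = i} s∈ with ∈-map⁻ (xv i) s∈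
  ... | j , _ , refl = xv-form i j

  ∈-Svert : s ∈ Svert i → vertexOf s ≡ just i
  ∈-Svert (here refl) = refl
  ∈-Svert {i = i} (there s∈) with ∈-++⁻ (map (xv i) (nbrs i)) s∈
  ... | inj₂ (here refl) = refl
  ... | inj₁ s∈xs with ∈-Svert-xs s∈xs
  ...   | _ , _ , refl = refl

  ∈-Sedge : s ∈ Sedge i j → edgeOf s ≡ just (i , j)
  ∈-Sedge (here refl)                                         = refl
  ∈-Sedge (there (here refl))                                 = refl
  ∈-Sedge (there (there (here refl)))                         = refl
  ∈-Sedge (there (there (there (here refl))))                 = refl
  ∈-Sedge (there (there (there (there (here refl)))))         = refl
  ∈-Sedge (there (there (there (there (there (here refl)))))) = refl

  ∈-Sep : s ∈ Sep k → separatorOf s ≡ just k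
  ∈-Sep (here refl)                 = refl
  ∈-Sep (there (here refl))         = refl
  ∈-Sep (there (there (here refl))) = refl

  unique-Sep : ∀ k → Unique (Sep k)
  unique-Sep k = ((λ ()) ∷ (λ ()) ∷ []) ∷ ((λ ()) ∷ []) ∷ [] ∷ []

  vertexBlock : Fin n → List (Sym n)
  vertexBlock i = Svert i ++ Sep (suc (toℕ i))

  vertexPart : List (Sym n)
  vertexPart = concatMap vertexBlock (allFin n)

  edgeCandidates : Fin n → Fin n → List (Fin n × Fin n)
  edgeCandidates i j = if adj i j ∧ (toℕ i <ᵇ toℕ j) then (i , j) ∷ [] else []

  unique-edges : Unique edges
  unique-edges = unique-concatMap⁺ proj₁ (allFin⁺ n) unique-row row-tag
    where
    unique-row : ∀ i → Unique (concatMap (edgeCandidates i) (allFin n))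
    unique-row i = unique-concatMap⁺ proj₂ {allFin n} (allFin⁺ n) (λ j → unique-if-singleton _ (i , j))
                     (λ {_} {j} e∈ → cong proj₂ (∈-if-singleton (adj i j ∧ (toℕ i <ᵇ toℕ j)) e∈))

    row-tag : ∀ {e i} → e ∈ concatMap (edgeCandidates i) (allFin n) → proj₁ e ≡ i
    row-tag {i = i} e∈ with find (∈-concatMap⁻ (edgeCandidates i) {allFin n} e∈)
    ... | j , _ , e∈′ = cong proj₁ (∈-if-singleton (adj i j ∧ (toℕ i <ᵇ toℕ j)) e∈′)

  separatorOf-nothing⇒∉Sep : separatorOf s ≡ nothing → s ∉ Sep k
  separatorOf-nothing⇒∉Sep noSep s∈ with trans (sym noSep) (∈-Sep s∈)
  ... | ()

  count-Svert-nothing : ∀ s i → vertexOf s ≡ nothing → count s (Svert i) ≡ 0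
  count-Svert-nothing s i noVertex = ∉⇒count≡0 s∉
    where
    s∉ : s ∉ Svert i
    s∉ s∈ with trans (sym noVertex) (∈-Svert s∈)
    ... | ()

  count-Svert : ∀ s i → count s (Svert i) ≤ vertexWeight s
  count-Svert (w a) i = begin
    count (w a) (Svert i)
      ≡⟨ count-++-++ (w a) (w i ∷ []) xs ⟩
    count (w a) (w i ∷ []) + (count (w a) xs + count (w a) (w i ∷ []))
      ≡⟨ cong (λ c → count (w a) (w i ∷ []) + (c + count (w a) (w i ∷ []))) (∉⇒count≡0 w∉xs) ⟩
    count (w a) (w i ∷ []) + count (w a) (w i ∷ [])
      ≤⟨ ℕ.+-mono-≤ (count-[-]≤1 (w a) (w i)) (count-[-]≤1 (w a) (w i)) ⟩
    2 ∎
    where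
    open ℕ.≤-Reasoning
    xs = map (xv i) (nbrs i)
    w∉xs : w a ∉ xs
    w∉xs w∈ with ∈-Svert-xs w∈
    ... | _ , _ , ()
  count-Svert (x k a b) i = begin
    count (x k a b) (Svert i)                 ≡⟨ count-++-++ (x k a b) (w i ∷ []) (map (xv i) (nbrs i)) ⟩
    count (x k a b) (map (xv i) (nbrs i)) + 0 ≡⟨ ℕ.+-identityʳ _ ⟩
    count (x k a b) (map (xv i) (nbrs i))     ≤⟨ unique⇒count≤1 (x k a b) (unique-Svert-xs i) ⟩
    1                                         ∎
    where open ℕ.≤-Reasoning
  count-Svert s@(e¹ _ _)    i = ℕ.≤-reflexive (count-Svert-nothing s i refl)
  count-Svert s@(e² _ _)    i = ℕ.≤-reflexive (count-Svert-nothing s i refl)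
  count-Svert s@(sharp _ _) i = ℕ.≤-reflexive (count-Svert-nothing s i refl)

  count-Sedge≤2 : ∀ s i j → count s (Sedge i j) ≤ 2
  count-Sedge≤2 s i j = begin
    count s (Sedge i j)                                                      ≡⟨ count-++ s (e¹ i j ∷ x i i j ∷ e² i j ∷ []) ⟩
    count s (e¹ i j ∷ x i i j ∷ e² i j ∷ []) + count s (e¹ i j ∷ x j i j ∷ e² i j ∷ [])
                                                                             ≤⟨ ℕ.+-mono-≤ (unique⇒count≤1 s (half i)) (unique⇒count≤1 s (half j)) ⟩
    2                                                                        ∎
    where
    open ℕ.≤-Reasoning
    half : ∀ k → Unique (e¹ i j ∷ x k i j ∷ e² i j ∷ [])
    half k = ((λ ()) ∷ (λ ()) ∷ []) ∷ ((λ ()) ∷ []) ∷ [] ∷ []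

  count-Sedge : ∀ s i j → count s (Sedge i j) ≤ edgeWeight s
  count-Sedge (w a)         i j = z≤n
  count-Sedge s@(x _ _ _)   i j = count-Sedge≤2 s i j
  count-Sedge s@(e¹ _ _)    i j = count-Sedge≤2 s i j
  count-Sedge s@(e² _ _)    i j = count-Sedge≤2 s i j
  count-Sedge s@(sharp _ _) i j = count-Sedge≤2 s i j

  count-vertexPart : separatorOf s ≡ nothing → count s vertexPart ≤ vertexWeight s
  count-vertexPart {s} noSep = subst (_≤ vertexWeight s) (sym (count-concatMap vertexBlock (allFin n)))
    (sum-map-≤-singleSupport (allFin⁺ n) support bound)
    where
    bound : ∀ i → count s (vertexBlock i) ≤ vertexWeight s
    bound i = subst (_≤ vertexWeight s) (sym (count-++-∉ʳ s (Svert i) (separatorOf-nothing⇒∉Sep noSep)))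
                (count-Svert s i)

    owner : ∀ {i} → 0 < count s (vertexBlock i) → vertexOf s ≡ just i
    owner {i} pos with ∈-++⁻ (Svert i) (count-pos⇒∈ pos)
    ... | inj₁ s∈ = ∈-Svert s∈
    ... | inj₂ s∈ = ⊥-elim (separatorOf-nothing⇒∉Sep noSep s∈)

    support : ∀ {i i′} → 0 < count s (vertexBlock i) → 0 < count s (vertexBlock i′) → i ≡ i′
    support pos pos′ = Maybe.just-injective (trans (sym (owner pos)) (owner pos′))

  count-edgePart : separatorOf s ≡ nothing → ∀ k es →
                   count s (edgePart k es) ≡ sum (map (count s ∘ uncurry Sedge) es)
  count-edgePart noSep k []             = refl
  count-edgePart {s} noSep k ((i , j) ∷ es) = begin
    count s (Sedge i j ++ Sep k ++ edgePart (suc k) es)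
      ≡⟨ count-++-++ s (Sedge i j) (Sep k) ⟩
    count s (Sedge i j) + (count s (Sep k) + count s (edgePart (suc k) es))
      ≡⟨ cong (λ c → count s (Sedge i j) + (c + count s (edgePart (suc k) es))) (∉⇒count≡0 (separatorOf-nothing⇒∉Sep noSep)) ⟩
    count s (Sedge i j) + count s (edgePart (suc k) es)
      ≡⟨ cong (count s (Sedge i j) +_) (count-edgePart noSep (suc k) es) ⟩
    count s (Sedge i j) + sum (map (count s ∘ uncurry Sedge) es) ∎
    where open ≡-Reasoning

  count-edgePart≤ : separatorOf s ≡ nothing → ∀ k → count s (edgePart k edges) ≤ edgeWeight s
  count-edgePart≤ {s} noSep k = subst (_≤ edgeWeight s) (sym (count-edgePart noSep k edges))
    (sum-map-≤-singleSupport unique-edges support (λ (i , j) → count-Sedge s i j))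
    where
    owner : ∀ {e} → 0 < count s (uncurry Sedge e) → edgeOf s ≡ just e
    owner pos = ∈-Sedge (count-pos⇒∈ pos)

    support : ∀ {e e′} → 0 < count s (uncurry Sedge e) → 0 < count s (uncurry Sedge e′) → e ≡ e′
    support pos pos′ = Maybe.just-injective (trans (sym (owner pos)) (owner pos′))

  ∈-vertexBlock-sharp : ∀ {z} → sharp k z ∈ vertexBlock i → k ≡ suc (toℕ i)
  ∈-vertexBlock-sharp {i = i} s∈ with ∈-++⁻ (Svert i) s∈
  ... | inj₁ s∈Svert with ∈-Svert s∈Svert
  ...   | ()
  ∈-vertexBlock-sharp s∈ | inj₂ s∈Sep = Maybe.just-injective (∈-Sep s∈Sep)

  ∈-vertexPart-sharp : ∀ {z} → sharp k z ∈ vertexPart → k ≤ n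
  ∈-vertexPart-sharp s∈ with find (∈-concatMap⁻ vertexBlock {allFin n} s∈)
  ... | i , _ , s∈block rewrite ∈-vertexBlock-sharp s∈block = Fin.toℕ<n i

  ∈-edgePart-sharp : ∀ {k₀ es z} → sharp k z ∈ edgePart k₀ es → k₀ ≤ k
  ∈-edgePart-sharp {k₀ = k₀} {es = (i , j) ∷ es} s∈ with ∈-++⁻ (Sedge i j) s∈
  ... | inj₁ s∈Sedge with ∈-Sedge s∈Sedge
  ...   | ()
  ∈-edgePart-sharp {k₀ = k₀} {(i , j) ∷ es} s∈ | inj₂ s∈′ with ∈-++⁻ (Sep k₀) s∈′
  ... | inj₁ s∈Sep  = ℕ.≤-reflexive (sym (Maybe.just-injective (∈-Sep s∈Sep)))
  ... | inj₂ s∈rest = ℕ.<⇒≤ (∈-edgePart-sharp {es = es} s∈rest)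

  count-Sep≤1 : ∀ s k → count s (Sep k) ≤ 1
  count-Sep≤1 s k = unique⇒count≤1 s (unique-Sep k)

  count-vertexPart-sharp : ∀ z → count (sharp k z) vertexPart ≤ 1
  count-vertexPart-sharp {k} z = subst (_≤ 1) (sym (count-concatMap vertexBlock (allFin n)))
    (sum-map-≤-singleSupport (allFin⁺ n) support bound)
    where
    bound : ∀ i → count (sharp k z) (vertexBlock i) ≤ 1
    bound i = begin
      count (sharp k z) (Svert i ++ Sep (suc (toℕ i)))
        ≡⟨ count-++ (sharp k z) (Svert i) ⟩
      count (sharp k z) (Svert i) + count (sharp k z) (Sep (suc (toℕ i)))
        ≡⟨ cong (_+ count (sharp k z) (Sep (suc (toℕ i)))) (count-Svert-nothing (sharp k z) i refl) ⟩
      count (sharp k z) (Sep (suc (toℕ i)))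
        ≤⟨ count-Sep≤1 (sharp k z) (suc (toℕ i)) ⟩
      1 ∎
      where open ℕ.≤-Reasoning

    support : ∀ {i i′} → 0 < count (sharp k z) (vertexBlock i) → 0 < count (sharp k z) (vertexBlock i′) → i ≡ i′
    support pos pos′ = Fin.toℕ-injective (ℕ.suc-injective
      (trans (sym (∈-vertexBlock-sharp (count-pos⇒∈ pos))) (∈-vertexBlock-sharp (count-pos⇒∈ pos′))))

  count-edgePart-sharp : ∀ z k₀ es → count (sharp k z) (edgePart k₀ es) ≤ 1
  count-edgePart-sharp z k₀ []             = z≤n
  count-edgePart-sharp {k} z k₀ ((i , j) ∷ es) = begin
    count (sharp k z) (edgePart k₀ ((i , j) ∷ es))
      ≡⟨ count-++-++ (sharp k z) (Sedge i j) (Sep k₀) ⟩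
    count (sharp k z) (Sep k₀) + count (sharp k z) (edgePart (suc k₀) es)
      ≤⟨ here-or-later (k ℕ.≟ k₀) ⟩
    1 ∎
    where
    open ℕ.≤-Reasoning
    here-or-later : Dec (k ≡ k₀) → count (sharp k z) (Sep k₀) + count (sharp k z) (edgePart (suc k₀) es) ≤ 1
    here-or-later (yes k≡k₀) = begin
      count (sharp k z) (Sep k₀) + count (sharp k z) (edgePart (suc k₀) es)
        ≡⟨ cong (count (sharp k z) (Sep k₀) +_) (∉⇒count≡0 later∉) ⟩
      count (sharp k z) (Sep k₀) + 0
        ≡⟨ ℕ.+-identityʳ _ ⟩
      count (sharp k z) (Sep k₀)
        ≤⟨ count-Sep≤1 (sharp k z) k₀ ⟩
      1 ∎
      where
      later∉ : sharp k z ∉ edgePart (suc k₀) es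
      later∉ s∈ = ℕ.<⇒≢ (∈-edgePart-sharp {es = es} s∈) (sym k≡k₀)
    here-or-later (no k≢k₀) = begin
      count (sharp k z) (Sep k₀) + count (sharp k z) (edgePart (suc k₀) es)
        ≡⟨ cong (_+ count (sharp k z) (edgePart (suc k₀) es)) (∉⇒count≡0 sep∉) ⟩
      count (sharp k z) (edgePart (suc k₀) es)
        ≤⟨ count-edgePart-sharp z (suc k₀) es ⟩
      1 ∎
      where
      sep∉ : sharp k z ∉ Sep k₀
      sep∉ = k≢k₀ ∘ Maybe.just-injective ∘ ∈-Sep

  count-S-sharp≤1 : ∀ z → count (sharp k z) S ≤ 1
  count-S-sharp≤1 {k} z = begin
    count (sharp k z) S                                                        ≡⟨ count-++ (sharp k z) vertexPart ⟩
    count (sharp k z) vertexPart + count (sharp k z) (edgePart (suc n) edges) ≤⟨ one-side-empty (k ℕ.≤? n) ⟩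
    1                                                                          ∎
    where
    open ℕ.≤-Reasoning
    one-side-empty : Dec (k ≤ n) → count (sharp k z) vertexPart + count (sharp k z) (edgePart (suc n) edges) ≤ 1
    one-side-empty (yes k≤n) = begin
      count (sharp k z) vertexPart + count (sharp k z) (edgePart (suc n) edges)
        ≡⟨ cong (count (sharp k z) vertexPart +_) (∉⇒count≡0 edges∌) ⟩
      count (sharp k z) vertexPart + 0 ≡⟨ ℕ.+-identityʳ _ ⟩
      count (sharp k z) vertexPart     ≤⟨ count-vertexPart-sharp z ⟩
      1                                ∎
      where
      edges∌ : sharp k z ∉ edgePart (suc n) edges
      edges∌ s∈ = ℕ.<⇒≱ (∈-edgePart-sharp {es = edges} s∈) k≤n
    one-side-empty (no k≰n) = begin
      count (sharp k z) vertexPart + count (sharp k z) (edgePart (suc n) edges)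
        ≡⟨ cong (_+ count (sharp k z) (edgePart (suc n) edges)) (∉⇒count≡0 vertices∌) ⟩
      count (sharp k z) (edgePart (suc n) edges) ≤⟨ count-edgePart-sharp z (suc n) edges ⟩
      1                                          ∎
      where
      vertices∌ : sharp k z ∉ vertexPart
      vertices∌ = k≰n ∘ ∈-vertexPart-sharp

  count-S-Sep≤1 : ∀ {b} → b ∈ Sep k → count b S ≤ 1
  count-S-Sep≤1 (here refl)                 = count-S-sharp≤1 _
  count-S-Sep≤1 (there (here refl))         = count-S-sharp≤1 _
  count-S-Sep≤1 (there (there (here refl))) = count-S-sharp≤1 _

  count-S-nonseparator : ∀ s → separatorOf s ≡ nothing → count s S ≤ 3
  count-S-nonseparator s noSep = begin
    count s S                                             ≡⟨ count-++ s vertexPart ⟩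
    count s vertexPart + count s (edgePart (suc n) edges) ≤⟨ ℕ.+-mono-≤ (count-vertexPart noSep) (count-edgePart≤ noSep (suc n)) ⟩
    vertexWeight s + edgeWeight s                         ≤⟨ weights≤3 s ⟩
    3                                                     ∎
    where open ℕ.≤-Reasoning

  count-S≤3 : ∀ s → count s S ≤ 3
  count-S≤3 (sharp k z)   = ℕ.≤-trans (count-S-sharp≤1 z) (s≤s z≤n)
  count-S≤3 s@(w _)       = count-S-nonseparator s refl
  count-S≤3 s@(x _ _ _)   = count-S-nonseparator s refl
  count-S≤3 s@(e¹ _ _)    = count-S-nonseparator s refl
  count-S≤3 s@(e² _ _)    = count-S-nonseparator s refl

  Sep-infix-vertexPart : ∀ i → Sep (suc (toℕ i)) IsInfixOf vertexPart
  Sep-infix-vertexPart i = infix-concatMap vertexBlock (∈-allFin i)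
    (Svert i , [] , cong (Svert i ++_) (sym (++-identityʳ (Sep (suc (toℕ i))))))

  Sep-infix-edgePart : ∀ k₀ es d → d < length es → Sep (k₀ + d) IsInfixOf edgePart k₀ es
  Sep-infix-edgePart k₀ ((i , j) ∷ es) zero    _       =
    Sedge i j , edgePart (suc k₀) es , cong (λ k → Sedge i j ++ Sep k ++ edgePart (suc k₀) es) (sym (ℕ.+-identityʳ k₀))
  Sep-infix-edgePart k₀ ((i , j) ∷ es) (suc d) (s≤s d<) =
    subst (λ k → Sep k IsInfixOf edgePart k₀ ((i , j) ∷ es)) (sym (ℕ.+-suc k₀ d))
      (infix-++ˡ (Sedge i j) (infix-++ˡ (Sep k₀) (Sep-infix-edgePart (suc k₀) es d d<)))

  Sep-infix-S : ∀ k → 1 ≤ k → k ≤ m + n → Sep k IsInfixOf S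
  Sep-infix-S (suc k) _ k≤m+n with suc k ℕ.≤? n
  ... | yes k<n = infix-++ʳ (edgePart (suc n) edges)
    (subst (λ t → Sep (suc t) IsInfixOf vertexPart) (Fin.toℕ-fromℕ< k<n) (Sep-infix-vertexPart (fromℕ< k<n)))
  ... | no  k≮n = subst (λ t → Sep t IsInfixOf S) n+d≡k (infix-++ˡ vertexPart (Sep-infix-edgePart (suc n) edges d d<m))
    where
    d = suc k ∸ suc n
    n+d≡k : suc n + d ≡ suc k
    n+d≡k = ℕ.m+[n∸m]≡n (ℕ.≰⇒> k≮n)
    d<m : d < m
    d<m = ℕ.+-cancelˡ-< n d m (subst₂ _≤_ (sym n+d≡k) (ℕ.+-comm m n) k≤m+n)

  all⇒containsSep : ∀ {R} → All (_∈ R) (Sep k) → ContainsSep k R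
  all⇒containsSep (p₀ ∷ _  ∷ _  ∷ []) fzero               = p₀
  all⇒containsSep (_  ∷ p₁ ∷ _  ∷ []) (fsuc fzero)        = p₁
  all⇒containsSep (_  ∷ _  ∷ p₂ ∷ []) (fsuc (fsuc fzero)) = p₂

  exchange-at-separator : ∀ {R} → 1 ≤ k → k ≤ m + n → R ⊆ S → Contiguous R → ¬ All (_∈ R) (Sep k) →
                          ExchangeResult S (Sep k) R
  exchange-at-separator {k} {R} 1≤k k≤m+n R⊆S contiguous-R Sep⊄R with Sep-infix-S k 1≤k k≤m+n
  ... | P , Q , S≡ = subst (λ T → ExchangeResult T (Sep k) R) (sym S≡)
        (exchange (unique-Sep k) (proj₁ ∘ Sep∉) (proj₂ ∘ Sep∉) fewInQ (subst (R ⊆_) S≡ R⊆S) contiguous-R Sep⊄R)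
    where
    Sep∉ : ∀ {b} → b ∈ Sep k → b ∉ P × b ∉ Q
    Sep∉ {b} b∈ = count≤1⇒∉-sides P {Sep k} (subst (λ T → count b T ≤ 1) S≡ (count-S-Sep≤1 b∈)) b∈

    fewInQ : ∀ {a} → a ∈ P → count a Q < length (Sep k)
    fewInQ {a} = count-right< P {Sep k} (subst (λ T → count a T ≤ 3) S≡ (count-S≤3 a))

lemma3 : ∀ {n : ℕ} (G : CubicGraph n) (R : List (Sym n)) →
    IsRunSubseq R (Construction.S G) →
    ∀ (i : ℕ) → 1 ≤ i → i ≤ Construction.m G + n → ¬ ContainsSep i R →
    Σ (List (Sym n)) (λ R′ → IsRunSubseq R′ (Construction.S G) × ContainsSep i R′ × length R < length R′)
lemma3 G R (R⊆S , run) i 1≤i i≤m+n R∌Sep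
  with Gadgets.exchange-at-separator G 1≤i i≤m+n R⊆S (hasRunProperty⇒contiguous run)
         (R∌Sep ∘ Gadgets.all⇒containsSep G)
... | R′ , R′⊆S , contiguous-R′ , Sep⊆R′ , longer =
  R′ , (R′⊆S , contiguous⇒hasRunProperty contiguous-R′) , Gadgets.all⇒containsSep G Sep⊆R′ , longer
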